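{- Let $k_\mathcal{G}=n_\mathcal{G}\ge1$ and $k_\mathcal{H}=n_\mathcal{H}-d\ge1$ for some integer $d\ge0$. Let $g\in V(\mathcal{G})$ and $T\subseteq V(\mathcal{H})$ with $|T|=d+1$. Then $\prod_{h\in T}(1-x_{gh})\in I_{\mathrm{viz}}$. Moreover, $\prod_{h\in T}x_{gh}\equiv\sum_{r=0}^{d}(-1)^{d+r}\sum_{U\subseteq T,\,|U|=r}\prod_{h\in U}x_{gh}\pmod{I_{\mathrm{viz}}}$.
   Context: $\mathbb{K}$ is a subfield of $\mathbb{R}$. $V(\mathcal{G})$ is a set of $n_\mathcal{G}$ vertices with fixed subset $D_\mathcal{G}$ of size $k_\mathcal{G}$; $V(\mathcal{H})$ a disjoint set of $n_\mathcal{H}$ vertices with fixed subset $D_\mathcal{H}$ of size $k_\mathcal{H}$. Variables $e_{gg'}=e_{g'g}$ for 2-subsets of $V(\mathcal{G})$, $e_{hh'}$ for 2-subsets of $V(\mathcal{H})$, $x_{gh}$ for $g\in V(\mathcal{G}),h\in V(\mathcal{H})$; $P$ is the polynomial ring over $\mathbb{K}$ in these. $I_{\mathrm{viz}}\subseteq P$ is generated by: $e_{gg'}^2-e_{gg'}$; $\prod_{g'\in D_\mathcal{G}}(1-e_{gg'})$ for $g\in V(\mathcal{G})\setminus D_\mathcal{G}$; $\prod_{g'\in V(\mathcal{G})\setminus S}\sum_{g\in S}e_{gg'}$ for $S\subseteq V(\mathcal{G})$, $|S|=k_\mathcal{G}-1$; the same three families for $\mathcal{H}$ (with $V(\mathcal{H}),D_\mathcal{H},k_\mathcal{H}$);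 $x_{gh}^2-x_{gh}$; and $(1-x_{gh})\prod_{g'\in V(\mathcal{G}),g'\ne g}(1-e_{gg'}x_{g'h})\prod_{h'\in V(\mathcal{H}),h'\ne h}(1-e_{hh'}x_{gh'})$ for all $g,h$. $a\equiv b\pmod I$ means $a-b\in I$. -}

module Defs where

open import Level using (Level; _⊔_)
open import Algebra.Bundles using (CommutativeRing)
open import Data.Nat as ℕ using (ℕ; zero; suc; _∸_)
open import Data.Bool using (Bool; true; false; if_then_else_)
open import Data.Fin using (Fin; _<_)
import Data.Fin as F

open import Data.Fin.Properties using (<-cmp)
open import Data.Fin.Subset using (Subset; ∁; ⁅_⁆; ∣_∣; _∉_)
open import Data.Vec using ([]; _∷_)
open import Data.List using (List; []; _∷_; _++_; map; foldr; filter; upTo)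
open import Data.Product using (Σ; _×_; _,_; ∃)
open import Relation.Nullary using (¬_)
open import Relation.Binary using (tri<; tri≈; tri>)
open import Relation.Binary.PropositionalEquality using (_≡_)

-- Fields of characteristic 0 (stdlib has no Field bundle).
-- A subfield of ℝ is exactly such a field (with an order).

ofNat : ∀ {c ℓ} (R : CommutativeRing c ℓ) → ℕ → CommutativeRing.Carrier R
ofNat R zero    = CommutativeRing.0# R
ofNat R (suc n) = CommutativeRing._+_ R (CommutativeRing.1# R) (ofNat R n)

record CharZeroField (c ℓ : Level) : Set (Level.suc (c ⊔ ℓ)) where
  field
    cring : CommutativeRing c ℓ
  open CommutativeRing cring
  field
    inverse  : ∀ a → ¬ (a ≈ 0#) → ∃ λ b → a * b ≈ 1#
    charZero : ∀ n → ¬ (ofNat cring (suc n) ≈ 0#)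

data Poly {c} (C : Set c) (V : Set) : Set c where
  con  : C → Poly C V
  var  : V → Poly C V
  _⊕_  : Poly C V → Poly C V → Poly C V
  _⊗_  : Poly C V → Poly C V → Poly C V
  ⊖_   : Poly C V → Poly C V

infixl 6 _⊕_
infixl 7 _⊗_

-- The variables of P : e_{gg'} (g < g'), e_{hh'} (h < h'), x_{gh}.
-- An unordered 2-subset {i,j} is represented by its ordered pair i < j.

data Var (nG nH : ℕ) : Set where
  eG : (i j : Fin nG) → i < j → Var nG nH
  eH : (i j : Fin nH) → i < j → Var nG nH
  xv : Fin nG → Fin nH → Var nG nH

-- The viz ideal, for a char-0 field K, graphs with vertex sets Fin nG,
-- Fin nH, distinguished subsets DG, DH of (intended) sizes kG, kH.

module Viz {c ℓ} (K : CharZeroField c ℓ) (nG nH kG kH : ℕ)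
           (DG : Subset nG) (DH : Subset nH) where
  open CharZeroField K using (cring)
  open CommutativeRing cring

  P : Set c
  P = Poly Carrier (Var nG nH)

  𝟘 𝟙 : P
  𝟘 = con 0#
  𝟙 = con 1#

  _⊝_ : P → P → P
  p ⊝ q = p ⊕ (⊖ q)
  infixl 6 _⊝_

  _^_ : P → ℕ → P
  p ^ zero  = 𝟙
  p ^ suc n = p ⊗ (p ^ n)

  eval : (Var nG nH → Carrier) → P → Carrier
  eval ρ (con a) = a
  eval ρ (var v) = ρ v
  eval ρ (p ⊕ q) = eval ρ p + eval ρ q
  eval ρ (p ⊗ q) = eval ρ p * eval ρ q
  eval ρ (⊖ p)   = - eval ρ p

  -- Equality in the polynomial ring P.  Since K is infinite (char 0),
  -- two polynomials are equal iff they agree at every point of K^{vars}.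
  _≈P_ : P → P → Set (c ⊔ ℓ)
  p ≈P q = ∀ ρ → eval ρ p ≈ eval ρ q

  prodOver : ∀ {n} → Subset n → (Fin n → P) → P
  prodOver []           f = 𝟙
  prodOver (b ∷ s) f = (if b then f F.zero else 𝟙) ⊗ prodOver s (λ i → f (F.suc i))

  sumOver : ∀ {n} → Subset n → (Fin n → P) → P
  sumOver []      f = 𝟘
  sumOver (b ∷ s) f = (if b then f F.zero else 𝟘) ⊕ sumOver s (λ i → f (F.suc i))

  sumList : ∀ {a} {A : Set a} → List A → (A → P) → P
  sumList xs f = foldr (λ a acc → f a ⊕ acc) 𝟘 xs

  subsetsOf : ∀ {n} → Subset n → List (Subset n)
  subsetsOf []          = [] ∷ []
  subsetsOf (false ∷ T) = map (false ∷_) (subsetsOf T)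
  subsetsOf (true ∷ T)  = map (false ∷_) (subsetsOf T) ++ map (true ∷_) (subsetsOf T)

  subsetsOfSize : ∀ {n} → Subset n → ℕ → List (Subset n)
  subsetsOfSize T r = filter (λ U → ∣ U ∣ ℕ.≟ r) (subsetsOf T)

  -- the variable e_{ij} = e_{ji} for i ≠ j (the value for i = j is never used)
  eG' : Fin nG → Fin nG → P
  eG' i j with <-cmp i j
  ... | tri< p _ _ = var (eG i j p)
  ... | tri≈ _ _ _ = 𝟘
  ... | tri> _ _ q = var (eG j i q)

  eH' : Fin nH → Fin nH → P
  eH' i j with <-cmp i j
  ... | tri< p _ _ = var (eH i j p)
  ... | tri≈ _ _ _ = 𝟘
  ... | tri> _ _ q = var (eH j i q)

  x : Fin nG → Fin nH → P
  x g h = var (xv g h)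

  data IsGen : P → Set c where
    idemEG : ∀ i j (p : i < j) → IsGen (var (eG i j p) ⊗ var (eG i j p) ⊝ var (eG i j p))
    domG   : ∀ g → g ∉ DG → IsGen (prodOver DG (λ g' → 𝟙 ⊝ eG' g g'))
    totG   : ∀ (S : Subset nG) → ∣ S ∣ ≡ kG ∸ 1 →
             IsGen (prodOver (∁ S) (λ g' → sumOver S (λ g → eG' g g')))
    idemEH : ∀ i j (p : i < j) → IsGen (var (eH i j p) ⊗ var (eH i j p) ⊝ var (eH i j p))
    domH   : ∀ h → h ∉ DH → IsGen (prodOver DH (λ h' → 𝟙 ⊝ eH' h h'))
    totH   : ∀ (S : Subset nH) → ∣ S ∣ ≡ kH ∸ 1 →
             IsGen (prodOver (∁ S) (λ h' → sumOver S (λ h → eH' h h')))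
    idemX  : ∀ g h → IsGen (x g h ⊗ x g h ⊝ x g h)
    vizX   : ∀ g h → IsGen ((𝟙 ⊝ x g h)
                          ⊗ prodOver (∁ ⁅ g ⁆) (λ g' → 𝟙 ⊝ eG' g g' ⊗ x g' h)
                          ⊗ prodOver (∁ ⁅ h ⁆) (λ h' → 𝟙 ⊝ eH' h h' ⊗ x g h'))

  _∈Iviz : P → Set (c ⊔ ℓ)
  a ∈Iviz = Σ (List (P × Σ P IsGen)) λ l →
              a ≈P sumList l (λ { (c' , q , _) → c' ⊗ q })

  _≡_mod-Iviz : P → P → Set (c ⊔ ℓ)
  a ≡ b mod-Iviz = (a ⊝ b) ∈Iviz

{-# OPTIONS --safe #-}
module Submission where

open import Level using (Level; _⊔_) renaming (suc to lsuc)
open import Algebra.Bundles using (CommutativeRing; RawRing)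
import Algebra.Construct.Pointwise as Pointwise
import Algebra.Lattice.Properties.BooleanAlgebra as BooleanAlgebra
open import Algebra.Morphism.Structures using (IsRingMonomorphism)
import Algebra.Morphism.RingMonomorphism as RingMonomorphism
open import Data.Bool using (true; false)
open import Data.Empty using (⊥-elim)
open import Data.Fin using (Fin; zero; suc)
open import Data.Fin.Properties using (<-cmp; <-asym; <-irrelevant)
open import Data.Fin.Subset using (Subset; ∣_∣; ∁; ⁅_⁆; _∈_; ⊥)
open import Data.Fin.Subset.Properties
  using (_∈?_; x∉p⇒x∈∁p; x∈∁p⇒x∉p; x≢y⇒x∉⁅y⁆; x∉⁅y⁆⇒x≢y; ∣∁p∣≡n∸∣p∣; ∣⁅x⁆∣≡1; ∪-∩-booleanAlgebra)
open import Data.Integer as ℤ using (ℤ; +_; -[1+_]; _⊖_)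
import Data.Integer.Properties as ℤ
open import Data.List using (List; []; _∷_; _++_; map; filter; upTo; [_])
open import Data.List.Properties using (foldr-map; map-upTo; upTo-∷ʳ; filter-++; filter-none; ++-identityʳ)
open import Data.List.Relation.Unary.All using (universal)
open import Data.List.Relation.Unary.All.Properties using (map⁺)
import Data.Maybe as Maybe
open import Data.Nat as ℕ using (ℕ; zero; suc; _∸_; _≤_; _<_; s≤s; z≤n)
import Data.Nat.Properties as ℕ
open import Data.Product using (_×_; _,_; proj₁; proj₂; ∃; map₁)
open import Data.Sum using (inj₁; inj₂)
open import Data.Vec using (_∷_; [])
open import Data.Vec.Base using (here; there)
open import Function using (_∘_; id)
open import Relation.Binary using (tri<; tri≈; tri>; _Respects_)
open import Relation.Binary.PropositionalEquality as ≡ using (_≡_)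
open import Relation.Nullary using (yes; no; does)
open import Relation.Nullary.Decidable using (dec⇒maybe)
open import Relation.Unary using (Pred; Decidable; _⊆_)

open import Defs

-- Write I for I_viz and (I ∶ a) = {b | a b ∈ I}.  When k_G = n_G, the totality generator for
-- S = V(G) ∖ {g'} is the sum of the idempotents e_{gg'} (g ≠ g'), and in characteristic 0 a sum
-- of idempotents lies in an ideal only if each summand does; so every e_{gg'} lies in I and the viz
-- generator at (g, h) reduces to (1 - x_{gh}) B_h with B_h = ∏_{h' ≠ h} (1 - e_{hh'} x_{gh'}).
-- Put Y = ∏_{h ∈ T} (1 - x_{gh}).  The totality generator for S = V(H) ∖ T, of size k_H - 1, is
-- ∏_{h ∈ T} σ_h with σ_h = ∑_{s ∈ S} e_{sh}, and each σ_h is a unit modulo (I ∶ Y): an ideal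
-- J ⊇ (I ∶ Y) containing σ_h contains every e_{sh} (s ∈ S) and every x_{gh'} (h' ∈ T), hence every
-- e_{hh'} x_{gh'}, hence 1 - B_h, while B_h ∈ (I ∶ Y).  So 1 ∈ (I ∶ Y), i.e. Y ∈ I.  The congruence
-- is the expansion Y = ∑_{r ≤ d+1} (-1)^r e_r(x_{gh} : h ∈ T), where e_{d+1} = ∏_{h ∈ T} x_{gh},
-- multiplied by (-1)^{d+1}.

-- The ring solver only cancels coefficients it can decide equal, so for an arbitrary commutative
-- ring we run it with ℤ-coefficients through the canonical homomorphism ℤ → R.
module IntegerCoefficients {c ℓ} (R : CommutativeRing c ℓ) where
  open CommutativeRing R
  open import Algebra.Properties.Ring ring using (-‿involutive; -0#≈0#; -‿distribˡ-*; -‿distribʳ-*)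
  open import Algebra.Properties.AbelianGroup +-abelianGroup using (⁻¹-anti-homo‿-; ⁻¹-∙-comm)
  open import Algebra.Properties.Group +-group using (//-rightDividesʳ)
  open import Algebra.Properties.Semiring.Mult.TCOptimised semiring
    using (×-homo-+; ×1-homo-*) renaming (_×_ to _·_)
  open import Algebra.Solver.Ring.AlmostCommutativeRing using (fromCommutativeRing; _-Raw-AlmostCommutative⟶_)
  open import Relation.Binary.Reasoning.Setoid setoid

  ⟦_⟧ : ℤ → Carrier
  ⟦ + n ⟧      = n · 1#
  ⟦ -[1+ n ] ⟧ = - (suc n · 1#)

  -‿homo : ∀ i → ⟦ ℤ.- i ⟧ ≈ - ⟦ i ⟧
  -‿homo (+ zero)  = sym -0#≈0#
  -‿homo (+ suc n) = refl
  -‿homo -[1+ n ]  = sym (-‿involutive _)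

  ⊖-homo-≥ : ∀ {m n} → n ≤ m → ⟦ m ⊖ n ⟧ ≈ m · 1# - n · 1#
  ⊖-homo-≥ {m} {n} n≤m = begin
    ⟦ m ⊖ n ⟧                      ≡⟨ ≡.cong ⟦_⟧ (ℤ.⊖-≥ n≤m) ⟩
    (m ∸ n) · 1#                   ≈⟨ //-rightDividesʳ (n · 1#) _ ⟨
    (m ∸ n) · 1# + n · 1# - n · 1# ≈⟨ +-congʳ (×-homo-+ 1# (m ∸ n) n) ⟨
    (m ∸ n ℕ.+ n) · 1# - n · 1#      ≡⟨ ≡.cong (λ k → k · 1# - n · 1#) (ℕ.m∸n+n≡m n≤m) ⟩
    m · 1# - n · 1#                ∎

  ⊖-homo : ∀ m n → ⟦ m ⊖ n ⟧ ≈ m · 1# - n · 1#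
  ⊖-homo m n with ℕ.≤-total n m
  ... | inj₁ n≤m = ⊖-homo-≥ n≤m
  ... | inj₂ m≤n = begin
    ⟦ m ⊖ n ⟧           ≡⟨ ≡.cong ⟦_⟧ (ℤ.⊖-swap m n) ⟩
    ⟦ ℤ.- (n ⊖ m) ⟧     ≈⟨ -‿homo (n ⊖ m) ⟩
    - ⟦ n ⊖ m ⟧         ≈⟨ -‿cong (⊖-homo-≥ m≤n) ⟩
    - (n · 1# - m · 1#) ≈⟨ ⁻¹-anti-homo‿- _ _ ⟩
    m · 1# - n · 1#     ∎

  +-homo : ∀ i j → ⟦ i ℤ.+ j ⟧ ≈ ⟦ i ⟧ + ⟦ j ⟧
  +-homo (+ m)    (+ n)    = ×-homo-+ 1# m n
  +-homo (+ m)    -[1+ n ] = ⊖-homo m (suc n)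
  +-homo -[1+ m ] (+ n)    = trans (⊖-homo n (suc m)) (+-comm _ _)
  +-homo -[1+ m ] -[1+ n ] = begin
    - (suc (suc m ℕ.+ n) · 1#)        ≡⟨ ≡.cong (λ k → - (k · 1#)) (ℕ.+-suc (suc m) n) ⟨
    - ((suc m ℕ.+ suc n) · 1#)        ≈⟨ -‿cong (×-homo-+ 1# (suc m) (suc n)) ⟩
    - (suc m · 1# + suc n · 1#)     ≈⟨ ⁻¹-∙-comm _ _ ⟨
    - (suc m · 1#) + - (suc n · 1#) ∎

  *-homo-+ : ∀ m n → ⟦ + m ℤ.* + n ⟧ ≈ ⟦ + m ⟧ * ⟦ + n ⟧
  *-homo-+ m n = trans (reflexive (≡.cong ⟦_⟧ (≡.sym (ℤ.pos-* m n)))) (×1-homo-* m n)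

  *-homo : ∀ i j → ⟦ i ℤ.* j ⟧ ≈ ⟦ i ⟧ * ⟦ j ⟧
  *-homo (+ m)    (+ n)    = *-homo-+ m n
  *-homo (+ m)    -[1+ n ] = begin
    ⟦ + m ℤ.* ℤ.- + suc n ⟧   ≡⟨ ≡.cong ⟦_⟧ (ℤ.neg-distribʳ-* (+ m) (+ suc n)) ⟨
    ⟦ ℤ.- (+ m ℤ.* + suc n) ⟧ ≈⟨ -‿homo (+ m ℤ.* + suc n) ⟩
    - ⟦ + m ℤ.* + suc n ⟧     ≈⟨ -‿cong (*-homo-+ m (suc n)) ⟩
    - (⟦ + m ⟧ * ⟦ + suc n ⟧) ≈⟨ -‿distribʳ-* _ _ ⟩
    ⟦ + m ⟧ * - ⟦ + suc n ⟧   ∎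
  *-homo -[1+ m ] (+ n)    = begin
    ⟦ ℤ.- + suc m ℤ.* + n ⟧   ≡⟨ ≡.cong ⟦_⟧ (ℤ.neg-distribˡ-* (+ suc m) (+ n)) ⟨
    ⟦ ℤ.- (+ suc m ℤ.* + n) ⟧ ≈⟨ -‿homo (+ suc m ℤ.* + n) ⟩
    - ⟦ + suc m ℤ.* + n ⟧     ≈⟨ -‿cong (*-homo-+ (suc m) n) ⟩
    - (⟦ + suc m ⟧ * ⟦ + n ⟧) ≈⟨ -‿distribˡ-* _ _ ⟩
    - ⟦ + suc m ⟧ * ⟦ + n ⟧   ∎
  *-homo -[1+ m ] -[1+ n ] = begin
    ⟦ + suc m ℤ.* + suc n ⟧         ≈⟨ *-homo-+ (suc m) (suc n) ⟩
    ⟦ + suc m ⟧ * ⟦ + suc n ⟧       ≈⟨ -‿involutive _ ⟨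
    - - (⟦ + suc m ⟧ * ⟦ + suc n ⟧) ≈⟨ -‿cong (-‿distribʳ-* _ _) ⟩
    - (⟦ + suc m ⟧ * - ⟦ + suc n ⟧) ≈⟨ -‿distribˡ-* _ _ ⟩
    - ⟦ + suc m ⟧ * - ⟦ + suc n ⟧   ∎

  morphism : ℤ.+-*-rawRing -Raw-AlmostCommutative⟶ fromCommutativeRing R
  morphism = record
    { ⟦_⟧ = ⟦_⟧ ; +-homo = +-homo ; *-homo = *-homo ; -‿homo = -‿homo
    ; 0-homo = refl ; 1-homo = refl }

  open import Algebra.Solver.Ring ℤ.+-*-rawRing (fromCommutativeRing R) morphism
    (λ i j → Maybe.map (reflexive ∘ ≡.cong ⟦_⟧) (dec⇒maybe (i ℤ.≟ j)))
    public using (Polynomial; solve; _:=_; _:+_; _:-_; _:*_; :-_) renaming (con to :con)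

  :1 : ∀ {n} → Polynomial n
  :1 = :con (+ 1)

filter-map : ∀ {a b p q} {A : Set a} {B : Set b} {P : Pred A p} {Q : Pred B q}
             (P? : Decidable P) (Q? : Decidable Q) (f : B → A) →
             (∀ x → does (P? (f x)) ≡ does (Q? x)) →
             ∀ xs → filter P? (map f xs) ≡ map f (filter Q? xs)
filter-map P? Q? f same []       = ≡.refl
filter-map P? Q? f same (x ∷ xs) rewrite same x with does (Q? x)
... | true  = ≡.cong (f x ∷_) (filter-map P? Q? f same xs)
... | false = filter-map P? Q? f same xs

module VizIdeal {c ℓ} (K : CharZeroField c ℓ) (nG nH kG kH : ℕ) (DG : Subset nG) (DH : Subset nH) where
  open Viz K nG nH kG kH DG DH
  open CharZeroField K using (cring; inverse; charZero)
  private module K = CommutativeRing cring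

  -- Unlike the function _≈P_, a record is injective, so the solver can infer both sides of its refl.
  infix 4 _≈_
  record _≈_ (p q : P) : Set (c ⊔ ℓ) where
    constructor mk≈
    field ≈P : p ≈P q

  polynomialRawRing : RawRing c (c ⊔ ℓ)
  polynomialRawRing = record
    { Carrier = P ; _≈_ = _≈_ ; _+_ = _⊕_ ; _*_ = _⊗_ ; -_ = ⊖_ ; 0# = 𝟘 ; 1# = 𝟙 }

  functionRing : CommutativeRing c (c ⊔ ℓ)
  functionRing = Pointwise.commutativeRing (Var nG nH → K.Carrier) cring

  eval-isRingMonomorphism : IsRingMonomorphism polynomialRawRing (CommutativeRing.rawRing functionRing)
                                               (λ p ρ → eval ρ p)
  eval-isRingMonomorphism = record
    { isRingHomomorphism = record
      { isSemiringHomomorphism = record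
        { isNearSemiringHomomorphism = record
          { +-isMonoidHomomorphism = record
            { isMagmaHomomorphism = record
              { isRelHomomorphism = record { cong = _≈_.≈P }
              ; homo              = λ _ _ _ → K.refl
              }
            ; ε-homo = λ _ → K.refl
            }
          ; *-homo = λ _ _ _ → K.refl
          }
        ; 1#-homo = λ _ → K.refl
        }
      ; -‿homo = λ _ _ → K.refl
      }
    ; injective = mk≈
    }

  polynomialRing : CommutativeRing c (c ⊔ ℓ)
  polynomialRing = record
    { isCommutativeRing = RingMonomorphism.isCommutativeRing eval-isRingMonomorphism
                            (CommutativeRing.isCommutativeRing functionRing)
    }

  open CommutativeRing polynomialRing
    using ( refl; sym; trans; reflexive; setoid; +-cong; +-congˡ; +-congʳ; +-assoc; +-identityˡ
          ; +-identityʳ; *-congˡ; *-congʳ; *-assoc; *-comm; *-identityˡ; *-identityʳ; distribˡ; zeroʳ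
          ; -‿inverseʳ; -‿cong; +-commutativeSemigroup; *-commutativeSemigroup)
  open import Algebra.Properties.CommutativeSemigroup +-commutativeSemigroup using (interchange)
  open import Algebra.Properties.CommutativeSemigroup *-commutativeSemigroup using (x∙yz≈y∙xz; xy∙z≈y∙xz)
  open IntegerCoefficients polynomialRing
  open import Relation.Binary.Reasoning.Setoid setoid

  module _ {a} {A : Set a} where

    sumList-++ : ∀ (xs ys : List A) (f : A → P) → sumList (xs ++ ys) f ≈ sumList xs f ⊕ sumList ys f
    sumList-++ []       ys f = sym (+-identityˡ _)
    sumList-++ (x ∷ xs) ys f = trans (+-congˡ (sumList-++ xs ys f)) (sym (+-assoc _ _ _))

    sumList-map : ∀ {b} {B : Set b} (h : B → A) (xs : List B) (f : A → P) →
                  sumList (map h xs) f ≡ sumList xs (f ∘ h)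
    sumList-map h xs f = foldr-map _ h 𝟘 xs

    sumList-cong : ∀ (xs : List A) {f g : A → P} → (∀ x → f x ≈ g x) → sumList xs f ≈ sumList xs g
    sumList-cong []       f≈g = refl
    sumList-cong (x ∷ xs) f≈g = +-cong (f≈g x) (sumList-cong xs f≈g)

    sumList-𝟘 : ∀ (xs : List A) → sumList xs (λ _ → 𝟘) ≈ 𝟘
    sumList-𝟘 []       = refl
    sumList-𝟘 (x ∷ xs) = trans (+-identityˡ _) (sumList-𝟘 xs)

    sumList-distrib-⊕ : ∀ (xs : List A) (f g : A → P) →
                        sumList xs (λ x → f x ⊕ g x) ≈ sumList xs f ⊕ sumList xs g
    sumList-distrib-⊕ []       f g = sym (+-identityˡ _)
    sumList-distrib-⊕ (x ∷ xs) f g = trans (+-congˡ (sumList-distrib-⊕ xs f g)) (interchange _ _ _ _)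

    sumList-⊗ˡ : ∀ (xs : List A) (r : P) (f : A → P) → sumList xs (λ x → r ⊗ f x) ≈ r ⊗ sumList xs f
    sumList-⊗ˡ []       r f = sym (zeroʳ r)
    sumList-⊗ˡ (x ∷ xs) r f = trans (+-congˡ (sumList-⊗ˡ xs r f)) (sym (distribˡ _ _ _))

  sumList-upTo-suc : ∀ N (F : ℕ → P) → sumList (upTo (suc N)) F ≡ F 0 ⊕ sumList (upTo N) (F ∘ suc)
  sumList-upTo-suc N F = ≡.cong (F 0 ⊕_)
    (≡.trans (≡.cong (λ xs → sumList xs F) (≡.sym (map-upTo suc N))) (sumList-map suc (upTo N) F))

  sumList-upTo-∷ʳ : ∀ N (F : ℕ → P) → sumList (upTo (suc N)) F ≈ sumList (upTo N) F ⊕ F N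
  sumList-upTo-∷ʳ N F = begin
    sumList (upTo (suc N)) F       ≡⟨ ≡.cong (λ xs → sumList xs F) (upTo-∷ʳ N) ⟨
    sumList (upTo N ++ [ N ]) F    ≈⟨ sumList-++ (upTo N) [ N ] F ⟩
    sumList (upTo N) F ⊕ (F N ⊕ 𝟘) ≈⟨ +-congˡ (+-identityʳ (F N)) ⟩
    sumList (upTo N) F ⊕ F N       ∎

  record IsIdeal (J : Pred P (c ⊔ ℓ)) : Set (c ⊔ ℓ) where
    field
      resp     : J Respects _≈_
      𝟘∈       : J 𝟘
      ⊕-closed : ∀ {a b} → J a → J b → J (a ⊕ b)
      ⊗-closed : ∀ r {a} → J a → J (r ⊗ a)

    ⊗-closedʳ : ∀ r {a} → J a → J (a ⊗ r)
    ⊗-closedʳ r a∈J = resp (*-comm r _) (⊗-closed r a∈J)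

  open IsIdeal

  infixl 5 _∶_
  _∶_ : Pred P (c ⊔ ℓ) → P → Pred P (c ⊔ ℓ)
  (J ∶ a) b = J (a ⊗ b)

  Idempotent : Pred P (c ⊔ ℓ) → P → Set (c ⊔ ℓ)
  Idempotent J e = J (e ⊗ e ⊝ e)

  module _ {J : Pred P (c ⊔ ℓ)} (J-ideal : IsIdeal J) where

    ∶-isIdeal : ∀ a → IsIdeal (J ∶ a)
    ∶-isIdeal a = record
      { resp     = λ b≈b′ → resp J-ideal (*-congˡ b≈b′)
      ; 𝟘∈       = resp J-ideal (sym (zeroʳ a)) (𝟘∈ J-ideal)
      ; ⊕-closed = λ ab∈J ab′∈J → resp J-ideal (sym (distribˡ a _ _)) (⊕-closed J-ideal ab∈J ab′∈J)
      ; ⊗-closed = λ r ab∈J → resp J-ideal (x∙yz≈y∙xz r a _) (⊗-closed J-ideal r ab∈J)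
      }

    ⊆-∶ : ∀ a → J ⊆ J ∶ a
    ⊆-∶ a = ⊗-closed J-ideal a

    𝟙∈∶⇒∈ : ∀ {a} → (J ∶ a) 𝟙 → J a
    𝟙∈∶⇒∈ = resp J-ideal (*-identityʳ _)

    ∈-split : ∀ {a} b → (J ∶ b) a → (J ∶ (𝟙 ⊝ b)) a → J a
    ∈-split {a} b ba∈J [𝟙⊝b]a∈J = resp J-ideal
      (solve 2 (λ a b → b :* a :+ (:1 :- b) :* a := a) refl a b)
      (⊕-closed J-ideal ba∈J [𝟙⊝b]a∈J)

    𝟙∈ : ∀ {b} → J b → J (𝟙 ⊝ b) → J 𝟙
    𝟙∈ {b} b∈J 𝟙⊝b∈J = ∈-split b (⊗-closedʳ J-ideal 𝟙 b∈J) (⊗-closedʳ J-ideal 𝟙 𝟙⊝b∈J)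

    idempotent⇒∈∶𝟙⊝ : ∀ {e} → Idempotent J e → (J ∶ (𝟙 ⊝ e)) e
    idempotent⇒∈∶𝟙⊝ {e} idem = resp J-ideal
      (solve 1 (λ e → :- :1 :* (e :* e :- e) := (:1 :- e) :* e) refl e) (⊗-closed J-ideal (⊖ 𝟙) idem)

    𝟙⊝∏𝟙⊝∈ : ∀ {n} (U : Subset n) (t : Fin n → P) → (∀ {i} → i ∈ U → J (t i)) →
             J (𝟙 ⊝ prodOver U (λ i → 𝟙 ⊝ t i))
    𝟙⊝∏𝟙⊝∈ []          t t∈J = resp J-ideal (sym (-‿inverseʳ 𝟙)) (𝟘∈ J-ideal)
    𝟙⊝∏𝟙⊝∈ (false ∷ U) t t∈J =
      resp J-ideal (+-congˡ (-‿cong (sym (*-identityˡ _)))) (𝟙⊝∏𝟙⊝∈ U (t ∘ suc) (t∈J ∘ there))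
    𝟙⊝∏𝟙⊝∈ (true ∷ U)  t t∈J = resp J-ideal
      (solve 2 (λ t₀ Π → :1 :- Π :+ Π :* t₀ := :1 :- (:1 :- t₀) :* Π) refl (t zero) _)
      (⊕-closed J-ideal (𝟙⊝∏𝟙⊝∈ U (t ∘ suc) (t∈J ∘ there)) (⊗-closed J-ideal _ (t∈J here)))

    ∶-⊆-∶-∏ : ∀ {n} (T : Subset n) (f : Fin n → P) {i} → i ∈ T → J ∶ f i ⊆ J ∶ prodOver T f
    ∶-⊆-∶-∏ (true ∷ T) f here        fa∈J =
      resp J-ideal (sym (xy∙z≈y∙xz (f zero) _ _)) (⊗-closed J-ideal (prodOver T (f ∘ suc)) fa∈J)
    ∶-⊆-∶-∏ (_ ∷ T)    f (there i∈T) fa∈J =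
      resp J-ideal (sym (*-assoc _ _ _)) (⊗-closed J-ideal _ (∶-⊆-∶-∏ T (f ∘ suc) i∈T fa∈J))

  -- A unit modulo J₀, phrased without forming the ideal J₀ + (a).
  UnitModulo : Pred P (c ⊔ ℓ) → P → Set (lsuc (c ⊔ ℓ))
  UnitModulo J₀ a = ∀ {J} → IsIdeal J → J₀ ⊆ J → J a → J 𝟙

  ∏-unitModulo : ∀ {n J₀} (T : Subset n) (σ : Fin n → P) →
                 (∀ {i} → i ∈ T → UnitModulo J₀ (σ i)) → UnitModulo J₀ (prodOver T σ)
  ∏-unitModulo []          σ units J-ideal J₀⊆J 𝟙∈J = 𝟙∈J
  ∏-unitModulo (false ∷ T) σ units J-ideal J₀⊆J ∏∈J =
    ∏-unitModulo T (σ ∘ suc) (units ∘ there) J-ideal J₀⊆J (resp J-ideal (*-identityˡ _) ∏∈J)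
  ∏-unitModulo (true ∷ T)  σ units J-ideal J₀⊆J ∏∈J = units here J-ideal J₀⊆J
    (𝟙∈∶⇒∈ J-ideal (∏-unitModulo T (σ ∘ suc) (units ∘ there)
      (∶-isIdeal J-ideal (σ zero)) (⊆-∶ J-ideal (σ zero) ∘ J₀⊆J) ∏∈J))

  infix 8 _·𝟙
  _·𝟙 : ℕ → P
  k ·𝟙 = con (ofNat cring k)

  suc·𝟙 : ∀ k → 𝟙 ⊕ k ·𝟙 ≈ suc k ·𝟙
  suc·𝟙 k = mk≈ (λ _ → K.refl)

  suc·𝟙-invertible : ∀ k → ∃ λ b → suc k ·𝟙 ⊗ b ≈ 𝟙
  suc·𝟙-invertible k with inverse (ofNat cring (suc k)) (charZero k)
  ... | b , kb≈1 = con b , mk≈ (λ _ → kb≈1)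

  -- Modulo J the f i behave like 0/1-values, so Σ f i + k can only vanish if k = 0 and every f i does.
  -- The induction splits the first summand e along 𝟙 = e + (𝟙 ⊝ e), passing to J ∶ e and J ∶ (𝟙 ⊝ e).
  idempotent-sum-∈ : ∀ {J n} → IsIdeal J → (S : Subset n) (f : Fin n → P) →
                     (∀ i → Idempotent J (f i)) → ∀ k → J (sumOver S f ⊕ k ·𝟙) →
                     (0 < k → J 𝟙) × (∀ {i} → i ∈ S → J (f i))
  idempotent-sum-∈     J-ideal []          f idem zero    sum∈J = (λ ()) , λ ()
  idempotent-sum-∈ {J} J-ideal []          f idem (suc k) sum∈J = (λ _ → 𝟙∈J) , λ ()
    where
    𝟙∈J : J 𝟙
    𝟙∈J with suc·𝟙-invertible k
    ... | b , kb≈𝟙 = resp J-ideal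
      (trans (*-congˡ (+-identityˡ _)) (trans (*-comm b _) kb≈𝟙)) (⊗-closed J-ideal b sum∈J)
  idempotent-sum-∈ {J} J-ideal (false ∷ S) f idem k       sum∈J =
    proj₁ tail , λ { (there i∈S) → proj₂ tail i∈S }
    where
    tail : (0 < k → J 𝟙) × (∀ {i} → i ∈ S → J (f (suc i)))
    tail = idempotent-sum-∈ J-ideal S (f ∘ suc) (idem ∘ suc) k (resp J-ideal (+-congʳ (+-identityˡ _)) sum∈J)
  idempotent-sum-∈ {J} J-ideal (true ∷ S)  f idem k       sum∈J =
      (λ 0<k → ∈-split J-ideal e (proj₁ on-e (s≤s z≤n)) (proj₁ on-𝟙⊝e 0<k))
    , λ { here        → 𝟙∈∶⇒∈ J-ideal (proj₁ on-e (s≤s z≤n))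
        ; (there i∈S) → ∈-split J-ideal e (proj₂ on-e i∈S) (proj₂ on-𝟙⊝e i∈S) }
    where
    e s : P
    e = f zero
    s = sumOver S (f ∘ suc)
    on-e : (0 < suc k → (J ∶ e) 𝟙) × (∀ {i} → i ∈ S → (J ∶ e) (f (suc i)))
    on-e = idempotent-sum-∈ (∶-isIdeal J-ideal e) S (f ∘ suc) (⊆-∶ J-ideal e ∘ idem ∘ suc) (suc k)
      (resp J-ideal
        (trans (solve 3 (λ e s m → e :* (e :+ s :+ m) :+ :- :1 :* (e :* e :- e) := e :* (s :+ (:1 :+ m)))
                  refl e s (k ·𝟙))
               (*-congˡ (+-congˡ (suc·𝟙 k))))
        (⊕-closed J-ideal (⊗-closed J-ideal e sum∈J) (⊗-closed J-ideal (⊖ 𝟙) (idem zero))))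
    on-𝟙⊝e : (0 < k → (J ∶ (𝟙 ⊝ e)) 𝟙) × (∀ {i} → i ∈ S → (J ∶ (𝟙 ⊝ e)) (f (suc i)))
    on-𝟙⊝e = idempotent-sum-∈ (∶-isIdeal J-ideal (𝟙 ⊝ e)) S (f ∘ suc) (⊆-∶ J-ideal (𝟙 ⊝ e) ∘ idem ∘ suc) k
      (resp J-ideal
        (solve 3 (λ e s m → (:1 :- e) :* (e :+ s :+ m) :+ (e :* e :- e) := (:1 :- e) :* (s :+ m))
          refl e s (k ·𝟙))
        (⊕-closed J-ideal (⊗-closed J-ideal (𝟙 ⊝ e) sum∈J) (idem zero)))

  idempotent-summands-∈ : ∀ {J n} → IsIdeal J → (S : Subset n) (f : Fin n → P) →
                          (∀ i → Idempotent J (f i)) → J (sumOver S f) → ∀ {i} → i ∈ S → J (f i)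
  idempotent-summands-∈ J-ideal S f idem sum∈J =
    proj₂ (idempotent-sum-∈ J-ideal S f idem 0 (resp J-ideal (sym (+-identityʳ _)) sum∈J))

  elementary : ∀ {n} → Subset n → ℕ → (Fin n → P) → P
  elementary T r f = sumList (subsetsOfSize T r) (λ U → prodOver U f)

  alternating : ∀ {n} → Subset n → (Fin n → P) → ℕ → P
  alternating T f N = sumList (upTo N) (λ r → ((⊖ 𝟙) ^ r) ⊗ elementary T r f)

  module _ {n} (T : Subset n) where

    subsetsOfSize-false : ∀ r → subsetsOfSize (false ∷ T) r ≡ map (false ∷_) (subsetsOfSize T r)
    subsetsOfSize-false r = filter-map _ _ (false ∷_) (λ _ → ≡.refl) (subsetsOf T)

    subsetsOfSize-true-zero : subsetsOfSize (true ∷ T) 0 ≡ map (false ∷_) (subsetsOfSize T 0)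
    subsetsOfSize-true-zero = ≡.trans (filter-++ size≟0 (map (false ∷_) (subsetsOf T)) _)
      (≡.trans (≡.cong₂ _++_ (subsetsOfSize-false 0)
                             (filter-none size≟0 (map⁺ (universal (λ _ ()) (subsetsOf T)))))
               (++-identityʳ _))
      where
      size≟0 : Decidable (λ (U : Subset (suc n)) → ∣ U ∣ ≡ 0)
      size≟0 U = ∣ U ∣ ℕ.≟ 0

    subsetsOfSize-true-suc : ∀ r → subsetsOfSize (true ∷ T) (suc r) ≡
                             map (false ∷_) (subsetsOfSize T (suc r)) ++ map (true ∷_) (subsetsOfSize T r)
    subsetsOfSize-true-suc r = ≡.trans (filter-++ _ (map (false ∷_) (subsetsOf T)) _)
      (≡.cong₂ _++_ (subsetsOfSize-false (suc r)) (filter-map _ _ (true ∷_) (λ _ → ≡.refl) (subsetsOf T)))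

  module _ {n} (T : Subset n) (f : Fin (suc n) → P) where

    private
      ∑∏-≡ : ∀ {L L′ : List (Subset (suc n))} → L ≡ L′ →
             sumList L (λ U → prodOver U f) ≈ sumList L′ (λ U → prodOver U f)
      ∑∏-≡ = reflexive ∘ ≡.cong (λ L → sumList L (λ U → prodOver U f))

      ∑∏-map-false : ∀ L → sumList (map (false ∷_) L) (λ U → prodOver U f) ≈
                           sumList L (λ U → prodOver U (f ∘ suc))
      ∑∏-map-false L = trans (reflexive (sumList-map (false ∷_) L _)) (sumList-cong L (λ _ → *-identityˡ _))

      ∑∏-map-true : ∀ L → sumList (map (true ∷_) L) (λ U → prodOver U f) ≈
                          f zero ⊗ sumList L (λ U → prodOver U (f ∘ suc))
      ∑∏-map-true L = trans (reflexive (sumList-map (true ∷_) L _)) (sumList-⊗ˡ L (f zero) _)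

    elementary-false : ∀ r → elementary (false ∷ T) r f ≈ elementary T r (f ∘ suc)
    elementary-false r = trans (∑∏-≡ (subsetsOfSize-false T r)) (∑∏-map-false (subsetsOfSize T r))

    elementary-true-zero : elementary (true ∷ T) 0 f ≈ elementary T 0 (f ∘ suc)
    elementary-true-zero = trans (∑∏-≡ (subsetsOfSize-true-zero T)) (∑∏-map-false (subsetsOfSize T 0))

    elementary-true-suc : ∀ r → elementary (true ∷ T) (suc r) f ≈
                                elementary T (suc r) (f ∘ suc) ⊕ f zero ⊗ elementary T r (f ∘ suc)
    elementary-true-suc r = trans (∑∏-≡ (subsetsOfSize-true-suc T r))
      (trans (sumList-++ (map (false ∷_) (subsetsOfSize T (suc r))) (map (true ∷_) (subsetsOfSize T r)) _)
             (+-cong (∑∏-map-false (subsetsOfSize T (suc r))) (∑∏-map-true (subsetsOfSize T r))))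

    alternating-false : ∀ N → alternating (false ∷ T) f N ≈ alternating T (f ∘ suc) N
    alternating-false N = sumList-cong (upTo N) (λ r → *-congˡ (elementary-false r))

    alternating-true : ∀ M → alternating (true ∷ T) f (suc M) ≈
                             alternating T (f ∘ suc) (suc M) ⊕ (⊖ f zero) ⊗ alternating T (f ∘ suc) M
    alternating-true M = begin
      alternating (true ∷ T) f (suc M)
        ≡⟨ sumList-upTo-suc M _ ⟩
      s 0 ⊗ elementary (true ∷ T) 0 f ⊕ ∑ (λ r → s (suc r) ⊗ elementary (true ∷ T) (suc r) f)
        ≈⟨ +-cong (*-congˡ elementary-true-zero) (sumList-cong (upTo M) step) ⟩
      s 0 ⊗ E 0 ⊕ ∑ (λ r → s (suc r) ⊗ E (suc r) ⊕ (⊖ a) ⊗ (s r ⊗ E r))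
        ≈⟨ +-congˡ (sumList-distrib-⊕ (upTo M) _ _) ⟩
      s 0 ⊗ E 0 ⊕ (∑ (λ r → s (suc r) ⊗ E (suc r)) ⊕ ∑ (λ r → (⊖ a) ⊗ (s r ⊗ E r)))
        ≈⟨ +-congˡ (+-congˡ (sumList-⊗ˡ (upTo M) (⊖ a) _)) ⟩
      s 0 ⊗ E 0 ⊕ (∑ (λ r → s (suc r) ⊗ E (suc r)) ⊕ (⊖ a) ⊗ alternating T (f ∘ suc) M)
        ≈⟨ +-assoc _ _ _ ⟨
      (s 0 ⊗ E 0 ⊕ ∑ (λ r → s (suc r) ⊗ E (suc r))) ⊕ (⊖ a) ⊗ alternating T (f ∘ suc) M
        ≡⟨ ≡.cong (_⊕ (⊖ a) ⊗ alternating T (f ∘ suc) M) (sumList-upTo-suc M _) ⟨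
      alternating T (f ∘ suc) (suc M) ⊕ (⊖ a) ⊗ alternating T (f ∘ suc) M
        ∎
      where
      a : P
      a = f zero
      s E : ℕ → P
      s r = (⊖ 𝟙) ^ r
      E r = elementary T r (f ∘ suc)
      ∑ : (ℕ → P) → P
      ∑ = sumList (upTo M)
      step : ∀ r → s (suc r) ⊗ elementary (true ∷ T) (suc r) f ≈ s (suc r) ⊗ E (suc r) ⊕ (⊖ a) ⊗ (s r ⊗ E r)
      step r = trans (*-congˡ (elementary-true-suc r))
        (solve 4 (λ s e a e′ → (:- :1 :* s) :* (e :+ a :* e′) := (:- :1 :* s) :* e :+ :- a :* (s :* e′))
           refl (s r) (E (suc r)) a (E r))

  elementary-vanishes : ∀ {n} (T : Subset n) r (f : Fin n → P) → ∣ T ∣ < r → elementary T r f ≈ 𝟘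
  elementary-vanishes []          (suc r) f _           = refl
  elementary-vanishes (false ∷ T) r       f ∣T∣<r       =
    trans (elementary-false T f r) (elementary-vanishes T r _ ∣T∣<r)
  elementary-vanishes (true ∷ T)  (suc r) f (s≤s ∣T∣<r) = begin
    elementary (true ∷ T) (suc r) f
      ≈⟨ elementary-true-suc T f r ⟩
    elementary T (suc r) (f ∘ suc) ⊕ f zero ⊗ elementary T r (f ∘ suc)
      ≈⟨ +-cong (elementary-vanishes T (suc r) _ (ℕ.m<n⇒m<1+n ∣T∣<r))
                (*-congˡ (elementary-vanishes T r _ ∣T∣<r)) ⟩
    𝟘 ⊕ f zero ⊗ 𝟘
      ≈⟨ trans (+-identityˡ _) (zeroʳ _) ⟩
    𝟘 ∎

  elementary-top : ∀ {n} (T : Subset n) (f : Fin n → P) → elementary T ∣ T ∣ f ≈ prodOver T f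
  elementary-top []          f = +-identityʳ 𝟙
  elementary-top (false ∷ T) f =
    trans (elementary-false T f ∣ T ∣) (trans (elementary-top T _) (sym (*-identityˡ _)))
  elementary-top (true ∷ T)  f = begin
    elementary (true ∷ T) (suc ∣ T ∣) f
      ≈⟨ elementary-true-suc T f ∣ T ∣ ⟩
    elementary T (suc ∣ T ∣) (f ∘ suc) ⊕ f zero ⊗ elementary T ∣ T ∣ (f ∘ suc)
      ≈⟨ +-cong (elementary-vanishes T (suc ∣ T ∣) _ (ℕ.n<1+n _)) (*-congˡ (elementary-top T _)) ⟩
    𝟘 ⊕ f zero ⊗ prodOver T (f ∘ suc)
      ≈⟨ +-identityˡ _ ⟩
    prodOver (true ∷ T) f ∎

  ∏𝟙⊝≈alternating : ∀ {n} (T : Subset n) (f : Fin n → P) N → ∣ T ∣ < N →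
                    prodOver T (λ i → 𝟙 ⊝ f i) ≈ alternating T f N
  ∏𝟙⊝≈alternating []          f (suc M) _ = begin
    𝟙
      ≈⟨ sym (trans (+-identityʳ _) (trans (*-identityˡ _) (+-identityʳ _))) ⟩
    𝟙 ⊗ (𝟙 ⊕ 𝟘) ⊕ 𝟘
      ≈⟨ +-congˡ (sym (trans (sumList-cong (upTo M) (λ _ → zeroʳ _)) (sumList-𝟘 (upTo M)))) ⟩
    𝟙 ⊗ (𝟙 ⊕ 𝟘) ⊕ sumList (upTo M) (λ r → ((⊖ 𝟙) ^ suc r) ⊗ 𝟘)
      ≡⟨ sumList-upTo-suc M _ ⟨
    alternating [] f (suc M) ∎
  ∏𝟙⊝≈alternating (false ∷ T) f N       ∣T∣<N = trans (*-identityˡ _)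
    (trans (∏𝟙⊝≈alternating T (f ∘ suc) N ∣T∣<N) (sym (alternating-false T f N)))
  ∏𝟙⊝≈alternating (true ∷ T)  f (suc M) (s≤s ∣T∣<M) = begin
    (𝟙 ⊝ f zero) ⊗ Π
      ≈⟨ solve 2 (λ a Π → (:1 :- a) :* Π := Π :+ :- a :* Π) refl (f zero) Π ⟩
    Π ⊕ (⊖ f zero) ⊗ Π
      ≈⟨ +-cong (∏𝟙⊝≈alternating T (f ∘ suc) (suc M) (ℕ.m<n⇒m<1+n ∣T∣<M))
                (*-congˡ (∏𝟙⊝≈alternating T (f ∘ suc) M ∣T∣<M)) ⟩
    alternating T (f ∘ suc) (suc M) ⊕ (⊖ f zero) ⊗ alternating T (f ∘ suc) M
      ≈⟨ alternating-true T f M ⟨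
    alternating (true ∷ T) f (suc M) ∎
    where
    Π : P
    Π = prodOver T (λ i → 𝟙 ⊝ f (suc i))

  ^-+ : ∀ p m n → p ^ (m ℕ.+ n) ≈ p ^ m ⊗ p ^ n
  ^-+ p zero    n = sym (*-identityˡ _)
  ^-+ p (suc m) n = trans (*-congˡ (^-+ p m n)) (sym (*-assoc _ _ _))

  ⊖𝟙^-square : ∀ d → (⊖ 𝟙) ^ d ⊗ (⊖ 𝟙) ^ d ≈ 𝟙
  ⊖𝟙^-square zero    = *-identityˡ 𝟙
  ⊖𝟙^-square (suc d) = trans (solve 1 (λ s → (:- :1 :* s) :* (:- :1 :* s) := s :* s) refl _) (⊖𝟙^-square d)

  ∏-alternating-identity : ∀ {n} (T : Subset n) (f : Fin n → P) d → ∣ T ∣ ≡ suc d →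
    prodOver T f ⊝ sumList (upTo (suc d)) (λ r → ((⊖ 𝟙) ^ (d ℕ.+ r)) ⊗ elementary T r f)
    ≈ ⊖ ((⊖ 𝟙) ^ d) ⊗ prodOver T (λ i → 𝟙 ⊝ f i)
  ∏-alternating-identity T f d ∣T∣≡1+d = begin
    Π ⊝ sumList (upTo (suc d)) (λ r → ((⊖ 𝟙) ^ (d ℕ.+ r)) ⊗ elementary T r f)
      ≈⟨ +-congˡ (-‿cong shifted-sum) ⟩
    Π ⊝ s ⊗ alternating T f (suc d)
      ≈⟨ +-congʳ (trans (sym (*-identityʳ Π)) (*-congˡ (sym (⊖𝟙^-square d)))) ⟩
    Π ⊗ (s ⊗ s) ⊝ s ⊗ alternating T f (suc d)
      ≈⟨ solve 3 (λ s σ Π → Π :* (s :* s) :- s :* σ := :- s :* (σ :+ (:- :1 :* s) :* Π)) refl s _ Π ⟩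
    ⊖ s ⊗ (alternating T f (suc d) ⊕ (⊖ 𝟙 ⊗ s) ⊗ Π)
      ≈⟨ *-congˡ (+-congˡ (*-congˡ (sym top))) ⟩
    ⊖ s ⊗ (alternating T f (suc d) ⊕ (⊖ 𝟙 ⊗ s) ⊗ elementary T (suc d) f)
      ≈⟨ *-congˡ (sumList-upTo-∷ʳ (suc d) _) ⟨
    ⊖ s ⊗ alternating T f (suc (suc d))
      ≈⟨ *-congˡ (∏𝟙⊝≈alternating T f (suc (suc d)) ∣T∣<2+d) ⟨
    ⊖ s ⊗ prodOver T (λ i → 𝟙 ⊝ f i) ∎
    where
    Π s : P
    Π = prodOver T f
    s = (⊖ 𝟙) ^ d
    shifted-sum : sumList (upTo (suc d)) (λ r → ((⊖ 𝟙) ^ (d ℕ.+ r)) ⊗ elementary T r f) ≈ s ⊗ alternating T f (suc d)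
    shifted-sum = trans (sumList-cong (upTo (suc d)) (λ r → trans (*-congʳ (^-+ (⊖ 𝟙) d r)) (*-assoc _ _ _)))
                        (sumList-⊗ˡ (upTo (suc d)) s _)
    top : elementary T (suc d) f ≈ Π
    top = ≡.subst (λ k → elementary T k f ≈ Π) ∣T∣≡1+d (elementary-top T f)
    ∣T∣<2+d : ∣ T ∣ < suc (suc d)
    ∣T∣<2+d = ≡.subst (_< suc (suc d)) (≡.sym ∣T∣≡1+d) (ℕ.n<1+n _)

  -- Wrapped for the same reason as _≈_: the unfolding _∈Iviz would block unification of its argument.
  record Iviz (a : P) : Set (c ⊔ ℓ) where
    constructor mkIviz
    field unIviz : a ∈Iviz

  Iviz-isIdeal : IsIdeal Iviz
  Iviz-isIdeal = record
    { resp     = λ { a≈b (mkIviz (gens , a≈∑)) →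
                     mkIviz (gens , λ ρ → K.trans (K.sym (_≈_.≈P a≈b ρ)) (a≈∑ ρ)) }
    ; 𝟘∈       = mkIviz ([] , λ _ → K.refl)
    ; ⊕-closed = λ { (mkIviz (gens , a≈∑)) (mkIviz (gens′ , b≈∑)) → mkIviz (gens ++ gens′ , λ ρ →
                     K.trans (K.+-cong (a≈∑ ρ) (b≈∑ ρ)) (_≈_.≈P (sym (sumList-++ gens gens′ _)) ρ)) }
    ; ⊗-closed = λ { r (mkIviz (gens , a≈∑)) → mkIviz (map (map₁ (r ⊗_)) gens , λ ρ →
                     K.trans (K.*-congˡ (a≈∑ ρ)) (_≈_.≈P (scale r gens) ρ)) }
    }
    where
    scale : ∀ r gens → r ⊗ sumList gens (λ g → proj₁ g ⊗ proj₁ (proj₂ g))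
                       ≈ sumList (map (map₁ (r ⊗_)) gens) (λ g → proj₁ g ⊗ proj₁ (proj₂ g))
    scale r gens = trans (sym (sumList-⊗ˡ gens r _))
      (trans (sumList-cong gens (λ _ → sym (*-assoc _ _ _))) (reflexive (≡.sym (sumList-map _ gens _))))

  generator∈Iviz : ∀ {q} → IsGen q → Iviz q
  generator∈Iviz {q} isGen = mkIviz ([ 𝟙 , q , isGen ] , _≈_.≈P (sym (trans (+-identityʳ _) (*-identityˡ q))))

  𝟘-idempotent : Idempotent Iviz 𝟘
  𝟘-idempotent = resp Iviz-isIdeal (sym (trans (+-congʳ (zeroʳ 𝟘)) (-‿inverseʳ 𝟘))) (𝟘∈ Iviz-isIdeal)

  eG'-idempotent : ∀ i j → Idempotent Iviz (eG' i j)
  eG'-idempotent i j with <-cmp i j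
  ... | tri< i<j _ _ = generator∈Iviz (idemEG i j i<j)
  ... | tri≈ _ _ _   = 𝟘-idempotent
  ... | tri> _ _ j<i = generator∈Iviz (idemEG j i j<i)

  eH'-idempotent : ∀ i j → Idempotent Iviz (eH' i j)
  eH'-idempotent i j with <-cmp i j
  ... | tri< i<j _ _ = generator∈Iviz (idemEH i j i<j)
  ... | tri≈ _ _ _   = 𝟘-idempotent
  ... | tri> _ _ j<i = generator∈Iviz (idemEH j i j<i)

  eH'-sym : ∀ i j → eH' i j ≡ eH' j i
  eH'-sym i j with <-cmp i j | <-cmp j i
  ... | tri< i<j _ _ | tri< j<i _ _  = ⊥-elim (<-asym i<j j<i)
  ... | tri< _ i≢j _ | tri≈ _ j≡i _  = ⊥-elim (i≢j (≡.sym j≡i))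
  ... | tri< i<j _ _ | tri> _ _ i<j′ = ≡.cong (var ∘ eH i j) (<-irrelevant i<j i<j′)
  ... | tri≈ _ i≡j _ | tri< _ j≢i _  = ⊥-elim (j≢i (≡.sym i≡j))
  ... | tri≈ _ _ _   | tri≈ _ _ _    = ≡.refl
  ... | tri≈ _ i≡j _ | tri> _ j≢i _  = ⊥-elim (j≢i (≡.sym i≡j))
  ... | tri> _ _ j<i | tri< j<i′ _ _ = ≡.cong (var ∘ eH j i) (<-irrelevant j<i j<i′)
  ... | tri> _ i≢j _ | tri≈ _ j≡i _  = ⊥-elim (i≢j (≡.sym j≡i))
  ... | tri> _ _ j<i | tri> _ _ i<j  = ⊥-elim (<-asym i<j j<i)

  prodOver-⊥ : ∀ {n} (f : Fin n → P) → prodOver ⊥ f ≈ 𝟙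
  prodOver-⊥ {zero}  f = refl
  prodOver-⊥ {suc n} f = trans (*-identityˡ _) (prodOver-⊥ (f ∘ suc))

  prodOver-⁅⁆ : ∀ {n} (i : Fin n) (f : Fin n → P) → prodOver ⁅ i ⁆ f ≈ f i
  prodOver-⁅⁆ zero    f = trans (*-congˡ (prodOver-⊥ (f ∘ suc))) (*-identityʳ _)
  prodOver-⁅⁆ (suc i) f = trans (*-identityˡ _) (prodOver-⁅⁆ i (f ∘ suc))

  ∁-involutive : ∀ {n} (p : Subset n) → ∁ (∁ p) ≡ p
  ∁-involutive {n} = BooleanAlgebra.¬-involutive (∪-∩-booleanAlgebra n)

  ∈∁⁅⁆-sym : ∀ {n} {i j : Fin n} → i ∈ ∁ ⁅ j ⁆ → j ∈ ∁ ⁅ i ⁆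
  ∈∁⁅⁆-sym i∈ = x∉p⇒x∈∁p (x≢y⇒x∉⁅y⁆ (λ j≡i → x∉⁅y⁆⇒x≢y (x∈∁p⇒x∉p i∈) (≡.sym j≡i)))

  viz-H-factor : Fin nG → Fin nH → P
  viz-H-factor g h = prodOver (∁ ⁅ h ⁆) (λ h′ → 𝟙 ⊝ eH' h h′ ⊗ x g h′)

  module _ (kG≡nG : kG ≡ nG) where

    eG'∈Iviz : ∀ {i j} → i ∈ ∁ ⁅ j ⁆ → Iviz (eG' i j)
    eG'∈Iviz {j = j} = idempotent-summands-∈ Iviz-isIdeal S (λ i → eG' i j) (λ i → eG'-idempotent i j) ∑∈Iviz
      where
      S : Subset nG
      S = ∁ ⁅ j ⁆
      ∣S∣≡kG∸1 : ∣ S ∣ ≡ kG ∸ 1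
      ∣S∣≡kG∸1 = ≡.trans (∣∁p∣≡n∸∣p∣ ⁅ j ⁆) (≡.cong₂ _∸_ (≡.sym kG≡nG) (∣⁅x⁆∣≡1 j))
      ∑∈Iviz : Iviz (sumOver S (λ i → eG' i j))
      ∑∈Iviz = resp Iviz-isIdeal (prodOver-⁅⁆ j _)
        (≡.subst (λ X → Iviz (prodOver X (λ g′ → sumOver S (λ i → eG' i g′)))) (∁-involutive ⁅ j ⁆)
                 (generator∈Iviz (totG S ∣S∣≡kG∸1)))

    viz-H∈Iviz : ∀ g h → (Iviz ∶ (𝟙 ⊝ x g h)) (viz-H-factor g h)
    viz-H∈Iviz g h = 𝟙∈∶⇒∈ Iviz-isIdeal (𝟙∈ (∶-isIdeal Iviz-isIdeal z) ΠG∈ 𝟙⊝ΠG∈)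
      where
      z ΠG : P
      z  = (𝟙 ⊝ x g h) ⊗ viz-H-factor g h
      ΠG = prodOver (∁ ⁅ g ⁆) (λ g′ → 𝟙 ⊝ eG' g g′ ⊗ x g′ h)
      ΠG∈ : (Iviz ∶ z) ΠG
      ΠG∈ = resp Iviz-isIdeal (solve 3 (λ a b c → a :* b :* c := a :* c :* b) refl _ ΠG _)
                 (generator∈Iviz (vizX g h))
      𝟙⊝ΠG∈ : (Iviz ∶ z) (𝟙 ⊝ ΠG)
      𝟙⊝ΠG∈ = 𝟙⊝∏𝟙⊝∈ (∶-isIdeal Iviz-isIdeal z) (∁ ⁅ g ⁆) (λ g′ → eG' g g′ ⊗ x g′ h)
        (λ g′∈ → ⊆-∶ Iviz-isIdeal z (⊗-closedʳ Iviz-isIdeal (x _ h) (eG'∈Iviz (∈∁⁅⁆-sym g′∈))))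

    ∏𝟙⊝x∈Iviz : ∀ g (T : Subset nH) → ∣ ∁ T ∣ ≡ kH ∸ 1 → Iviz (prodOver T (λ h → 𝟙 ⊝ x g h))
    ∏𝟙⊝x∈Iviz g T ∣∁T∣≡kH∸1 =
      𝟙∈∶⇒∈ Iviz-isIdeal (∏-unitModulo T σ σ-unit (∶-isIdeal Iviz-isIdeal Y) id (⊆-∶ Iviz-isIdeal Y ∏σ∈Iviz))
      where
      Y : P
      Y = prodOver T (λ h → 𝟙 ⊝ x g h)
      σ : Fin nH → P
      σ h = sumOver (∁ T) (λ s → eH' s h)
      ∏σ∈Iviz : Iviz (prodOver T σ)
      ∏σ∈Iviz = ≡.subst (λ X → Iviz (prodOver X σ)) (∁-involutive T) (generator∈Iviz (totH (∁ T) ∣∁T∣≡kH∸1))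
      x∈ : ∀ {h} → h ∈ T → (Iviz ∶ Y) (x g h)
      x∈ h∈T = ∶-⊆-∶-∏ Iviz-isIdeal T (λ h → 𝟙 ⊝ x g h) h∈T
        (idempotent⇒∈∶𝟙⊝ Iviz-isIdeal (generator∈Iviz (idemX g _)))
      viz-H∈ : ∀ {h} → h ∈ T → (Iviz ∶ Y) (viz-H-factor g h)
      viz-H∈ h∈T = ∶-⊆-∶-∏ Iviz-isIdeal T (λ h → 𝟙 ⊝ x g h) h∈T (viz-H∈Iviz g _)
      σ-unit : ∀ {h} → h ∈ T → UnitModulo (Iviz ∶ Y) (σ h)
      σ-unit {h} h∈T {J} J-ideal ⊆J σ∈J =
        𝟙∈ J-ideal (⊆J (viz-H∈ h∈T)) (𝟙⊝∏𝟙⊝∈ J-ideal (∁ ⁅ h ⁆) (λ h′ → eH' h h′ ⊗ x g h′) t∈J)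
        where
        e∈J : ∀ {s} → s ∈ ∁ T → J (eH' s h)
        e∈J = idempotent-summands-∈ J-ideal (∁ T) (λ s → eH' s h)
          (λ s → ⊆J (⊆-∶ Iviz-isIdeal Y (eH'-idempotent s h))) σ∈J
        t∈J : ∀ {h′} → h′ ∈ ∁ ⁅ h ⁆ → J (eH' h h′ ⊗ x g h′)
        t∈J {h′} _ with h′ ∈? T
        ... | yes h′∈T = ⊗-closed J-ideal (eH' h h′) (⊆J (x∈ h′∈T))
        ... | no  h′∉T = ⊗-closedʳ J-ideal (x g h′) (≡.subst J (eH'-sym h′ h) (e∈J (x∉p⇒x∈∁p h′∉T)))

open import Data.Nat using (_+_)

lemma5p2 : ∀ {c ℓ : Level} (K : CharZeroField c ℓ)
    (nG nH kG kH d : ℕ) (DG : Subset nG) (DH : Subset nH) →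
    ∣ DG ∣ ≡ kG → ∣ DH ∣ ≡ kH →
    kG ≡ nG → 1 ≤ kG → kH + d ≡ nH → 1 ≤ kH →
    (g : Fin nG) (T : Subset nH) → ∣ T ∣ ≡ suc d →
    let open Viz K nG nH kG kH DG DH in
    (prodOver T (λ h → 𝟙 ⊝ x g h)) ∈Iviz
    × (prodOver T (λ h → x g h)
       ≡ sumList (upTo (suc d))
           (λ r → ((⊖ 𝟙) ^ (d + r))
                  ⊗ sumList (subsetsOfSize T r) (λ U → prodOver U (λ h → x g h)))
       mod-Iviz)
lemma5p2 K nG nH kG kH d DG DH _ _ kG≡nG _ kH+d≡nH _ g T ∣T∣≡1+d =
  Iviz.unIviz Y∈Iviz , Iviz.unIviz Y-multiple∈Iviz
  where
  open Viz K nG nH kG kH DG DH using (x; 𝟙; _⊝_; _^_; prodOver; sumList)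
  open VizIdeal K nG nH kG kH DG DH
  open IsIdeal Iviz-isIdeal using (resp; ⊗-closed)
  open ≡.≡-Reasoning
  ∣∁T∣≡kH∸1 : ∣ ∁ T ∣ ≡ kH ∸ 1
  ∣∁T∣≡kH∸1 = begin
    ∣ ∁ T ∣            ≡⟨ ∣∁p∣≡n∸∣p∣ T ⟩
    nH ∸ ∣ T ∣         ≡⟨ ≡.cong₂ _∸_ (≡.trans (≡.sym kH+d≡nH) (ℕ.+-comm kH d))
                                      (≡.trans ∣T∣≡1+d (ℕ.+-comm 1 d)) ⟩
    (d + kH) ∸ (d + 1) ≡⟨ ℕ.[m+n]∸[m+o]≡n∸o d kH 1 ⟩
    kH ∸ 1             ∎
  Y∈Iviz : Iviz (prodOver T (λ h → 𝟙 ⊝ x g h))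
  Y∈Iviz = ∏𝟙⊝x∈Iviz kG≡nG g T ∣∁T∣≡kH∸1
  Y-multiple∈Iviz : Iviz (prodOver T (x g) ⊝
                           sumList (upTo (suc d)) (λ r → ((⊖ 𝟙) ^ (d + r)) ⊗ elementary T r (x g)))
  Y-multiple∈Iviz = resp (CommutativeRing.sym polynomialRing (∏-alternating-identity T (x g) d ∣T∣≡1+d))
                           (⊗-closed _ Y∈Iviz)
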